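{- Let $G$ be any $k$-perfectly orientable graph. Then $\mathbf{src}(G)\le\mathbf{vsrc}(G)\le k|V(G)|$.
   Context: All graphs are finite, simple and undirected. A graph is $k$-perfectly orientable if there exists an orientation of its edges such that, for every vertex, its set of out-neighbors can be partitioned into at most $k$ cliques. A very strong rainbow coloring of $G$ is a coloring of $E(G)$ such that for every pair of vertices and every shortest path between them, all edges of that path receive pairwise different colors; $\mathbf{vsrc}(G)$ is the minimum number of colors in such a coloring. $\mathbf{src}(G)$ is the minimum number of colors in a coloring of $E(G)$ such that for every pair of vertices there exists at least one shortest path between them whose edges receive pairwise different colors. -}

module Defs where

open import Data.Nat using (ℕ; zero; suc; _≤_)
open import Data.Fin using (Fin)
open import Data.Bool using (Bool; true; false; not)
open import Data.List using (List; []; _∷_)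
open import Data.List.Relation.Unary.Unique.Propositional using (Unique)
open import Data.Product using (Σ; _×_; _,_; Σ-syntax)
open import Relation.Binary.PropositionalEquality using (_≡_; _≢_)

record Graph (n : ℕ) : Set where
  field
    adj   : Fin n → Fin n → Bool
    sym   : ∀ u v → adj u v ≡ adj v u
    irrefl : ∀ v → adj v v ≡ false
open Graph public

Edge : ∀ {n} → Graph n → Fin n → Fin n → Set
Edge G u v = adj G u v ≡ true

record Orientation {n} (G : Graph n) : Set where
  field
    arc      : Fin n → Fin n → Bool
    arc-edge : ∀ u v → arc u v ≡ true → Edge G u v
    one-dir  : ∀ u v → Edge G u v → arc u v ≡ not (arc v u)
open Orientation public

-- The out-neighbourhood of each vertex v is partitioned into at most k
-- cliques: each out-neighbour gets one of k classes, and distinct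
-- out-neighbours in the same class are adjacent.
KPerfectlyOrientable : ∀ {n} → ℕ → Graph n → Set
KPerfectlyOrientable {n} k G =
  Σ[ D ∈ Orientation G ]
  Σ[ cls ∈ ((v u : Fin n) → arc D v u ≡ true → Fin k) ]
    (∀ v u w (du : arc D v u ≡ true) (dw : arc D v w ≡ true) →
       cls v u du ≡ cls v w dw → u ≢ w → Edge G u w)

data Walk {n} (G : Graph n) : Fin n → Fin n → Set where
  []  : ∀ {u} → Walk G u u
  _∷_ : ∀ {u v w} → Edge G u v → Walk G v w → Walk G u w

length : ∀ {n} {G : Graph n} {u v} → Walk G u v → ℕ
length []      = zero
length (_ ∷ p) = suc (length p)

-- A shortest u–v path: a u–v walk of minimum length (such a walk is a path).
Shortest : ∀ {n} {G : Graph n} {u v} → Walk G u v → Set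
Shortest {G = G} {u} {v} p = ∀ (q : Walk G u v) → length p ≤ length q

record Colouring {n} (G : Graph n) (m : ℕ) : Set where
  field
    col     : (u v : Fin n) → Edge G u v → Fin m
    col-sym : ∀ u v (e : Edge G u v) (e' : Edge G v u) → col u v e ≡ col v u e'
open Colouring public

colours : ∀ {n} {G : Graph n} {m} → Colouring G m → ∀ {u v} → Walk G u v → List (Fin m)
colours c []                = []
colours c (_∷_ {u} {v} e p) = col c u v e ∷ colours c p

Rainbow : ∀ {n} {G : Graph n} {m} → Colouring G m → ∀ {u v} → Walk G u v → Set
Rainbow c p = Unique (colours c p)

StrongRainbow : ∀ {n} {G : Graph n} {m} → Colouring G m → Set
StrongRainbow {n} {G} c =
  ∀ (u v : Fin n) → Walk G u v → Σ[ p ∈ Walk G u v ] (Shortest p × Rainbow c p)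

VeryStrongRainbow : ∀ {n} {G : Graph n} {m} → Colouring G m → Set
VeryStrongRainbow {n} {G} c =
  ∀ (u v : Fin n) (p : Walk G u v) → Shortest p → Rainbow c p

HasSRC : ∀ {n} → Graph n → ℕ → Set
HasSRC G m = Σ[ c ∈ Colouring G m ] StrongRainbow c

HasVSRC : ∀ {n} → Graph n → ℕ → Set
HasVSRC G m = Σ[ c ∈ Colouring G m ] VeryStrongRainbow c

IsMin : (ℕ → Set) → ℕ → Set
IsMin P s = P s × (∀ m → P m → s ≤ m)

IsSrc : ∀ {n} → Graph n → ℕ → Set
IsSrc G = IsMin (HasSRC G)

IsVsrc : ∀ {n} → Graph n → ℕ → Set
IsVsrc G = IsMin (HasVSRC G)

-- Orient G so that every out-neighbourhood splits into k cliques, and give the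
-- edge u → v the colour (class of v in N⁺(u), u); there are at most k·n colours.
-- Each colour class lies in the closed clique {u} ∪ (a class of N⁺(u)), so any
-- two of its edges have endpoints at distance at most 1. If two edges of a
-- shortest path had the same colour, jumping from the first to the end of the
-- second would shorten the path; hence every shortest path is rainbow.
-- The inequality src ≤ vsrc holds because shortest paths exist.
module Submission where

open import Defs hiding (sym)
open import Data.Nat using (ℕ; zero; suc; _≤_; _<_; _*_; s≤s; z≤n)
open import Data.Nat.Properties using (≤-refl; ≤-trans; <-≤-trans; ≮⇒≥; n≮n; m≤n⇒m≤1+n)
open import Data.Nat.Induction using (<-wellFounded)
open import Induction.WellFounded using (Acc; acc)
open import Data.Bool using (true; false; not)
import Data.Bool as Bool
open import Data.Fin using (Fin; combine; _≟_)
open import Data.Fin.Properties using (any?; combine-injective)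
open import Data.Product using (Σ; Σ-syntax; _×_; _,_; proj₁; proj₂)
open import Data.Sum using (_⊎_; inj₁; inj₂)
open import Data.Empty using (⊥-elim)
open import Data.List.Relation.Unary.All using (All; []; _∷_)
open import Data.List.Relation.Unary.AllPairs using ([]; _∷_)
open import Relation.Nullary using (Dec; yes; no; ¬_)
open import Relation.Nullary.Decidable using (_×-dec_)
open import Relation.Binary.PropositionalEquality
  using (_≡_; _≢_; refl; sym; trans; cong; subst₂)
open import Axiom.UniquenessOfIdentityProofs using (module Decidable⇒UIP)

module _ {n} {G : Graph n} where

  edge-sym : ∀ {u v} → Edge G u v → Edge G v u
  edge-sym {u} {v} e = trans (Graph.sym G v u) e

  Near : Fin n → Fin n → Set
  Near u v = u ≡ v ⊎ Edge G u v

  _◅_ : ∀ {u v w} → Near u v → Walk G v w → Walk G u w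
  inj₁ refl ◅ p = p
  inj₂ e    ◅ p = e ∷ p

  length-◅ : ∀ {u v w} (uv : Near u v) (p : Walk G v w) → length (uv ◅ p) ≤ suc (length p)
  length-◅ (inj₁ refl) p = m≤n⇒m≤1+n ≤-refl
  length-◅ (inj₂ e)    p = ≤-refl

  ShorterWalk : ℕ → Fin n → Fin n → Set
  ShorterWalk m u v = Σ[ p ∈ Walk G u v ] length p < m

  shorterWalk? : ∀ m u v → Dec (ShorterWalk m u v)
  shorterWalk? zero    u v = no λ ()
  shorterWalk? (suc m) u v with u ≟ v
  ... | yes refl = yes ([] , s≤s z≤n)
  ... | no u≢v
    with any? (λ w → (adj G u w Bool.≟ true) ×-dec shorterWalk? m w v)
  ...   | yes (w , e , p , p<m) = yes (e ∷ p , s≤s p<m)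
  ...   | no ∄w = no λ where
            ([] , _)            → u≢v refl
            (e ∷ p , s≤s p<m) → ∄w (_ , e , p , p<m)

  shortestWalk : ∀ {u v} → Walk G u v → Σ (Walk G u v) Shortest
  shortestWalk p = go p (<-wellFounded (length p))
    where
    go : ∀ {u v} (p : Walk G u v) → Acc _<_ (length p) → Σ (Walk G u v) Shortest
    go {u} {v} p (acc rs) with shorterWalk? (length p) u v
    ... | yes (q , q<p) = go q (rs q<p)
    ... | no ∄q         = p , λ q → ≮⇒≥ λ q<p → ∄q (q , q<p)

  Shortest-tail : ∀ {u a v} (e : Edge G u a) (p : Walk G a v) → Shortest (e ∷ p) → Shortest p
  Shortest-tail e p sh q with sh (e ∷ q)
  ... | s≤s p≤q = p≤q

  veryStrong⇒strong : ∀ {m} {c : Colouring G m} → VeryStrongRainbow c → StrongRainbow c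
  veryStrong⇒strong vsr u v p with shortestWalk p
  ... | q , sh = q , sh , vsr u v q sh

  src≤vsrc : ∀ {s t} → IsSrc G s → HasVSRC G t → s ≤ t
  src≤vsrc (_ , minimal) (c , vsr) = minimal _ (c , veryStrong⇒strong vsr)

  -- Walks ending at v no longer than p include every suffix of p.
  colours-All : ∀ {m} (c : Colouring G m) (P : Fin m → Set) {a v} (p : Walk G a v) →
    (∀ {b d} (f : Edge G b d) (q : Walk G d v) → length (f ∷ q) ≤ length p → P (col c b d f)) →
    All P (colours c p)
  colours-All c P []      h = []
  colours-All c P (e ∷ p) h = h e p ≤-refl ∷ colours-All c P p (λ f q le → h f q (m≤n⇒m≤1+n le))

  ColourClassesSpanCliques : ∀ {m} → Colouring G m → Set
  ColourClassesSpanCliques c =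
    ∀ {u a b d} (e : Edge G u a) (f : Edge G b d) → col c u a e ≡ col c b d f → Near u d

  module _ {m} {c : Colouring G m} (cliques : ColourClassesSpanCliques c) where

    first-colour-fresh : ∀ {u a v} (e : Edge G u a) (p : Walk G a v) → Shortest (e ∷ p) →
      ∀ {b d} (f : Edge G b d) (q : Walk G d v) → length (f ∷ q) ≤ length p →
      col c u a e ≢ col c b d f
    first-colour-fresh e p sh f q fq≤p same =
      n≮n _ (<-≤-trans (s≤s (≤-trans (length-◅ ud q) fq≤p)) (sh (ud ◅ q)))
      where ud = cliques e f same

    cliqueColouring⇒veryStrong : VeryStrongRainbow c
    cliqueColouring⇒veryStrong u v []      sh = []
    cliqueColouring⇒veryStrong u v (e ∷ p) sh =
      colours-All c (col c _ _ e ≢_) p (first-colour-fresh e p sh)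
      ∷ cliqueColouring⇒veryStrong _ v p (Shortest-tail e p sh)

module KPerfectColouring {n} {G : Graph n} {k}
  (D : Orientation G)
  (cls : (v u : Fin n) → arc D v u ≡ true → Fin k)
  (clique : ∀ v u w (du : arc D v u ≡ true) (dw : arc D v w ≡ true) →
              cls v u du ≡ cls v w dw → u ≢ w → Edge G u w)
  where

  Arc : Fin n → Fin n → Set
  Arc u v = arc D u v ≡ true

  Arc-irrelevant : ∀ {u v} (d d' : Arc u v) → d ≡ d'
  Arc-irrelevant = Decidable⇒UIP.≡-irrelevant Bool._≟_

  Arc-asym : ∀ {u v} → Arc u v → ¬ Arc v u
  Arc-asym {u} {v} uv vu with trans (sym uv) (trans (one-dir D u v (arc-edge D u v uv)) (cong not vu))
  ... | ()

  Oriented : Fin n → Fin n → Set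
  Oriented u v = Arc u v ⊎ Arc v u

  orient : ∀ {u v} → Edge G u v → Oriented u v
  orient {u} {v} e with arc D v u | one-dir D u v e
  ... | true  | _  = inj₂ refl
  ... | false | uv = inj₁ uv

  tail : ∀ {u v} → Oriented u v → Fin n
  tail {u}     (inj₁ _) = u
  tail {v = v} (inj₂ _) = v

  class : ∀ {u v} → Oriented u v → Fin k
  class {u} {v} (inj₁ uv) = cls u v uv
  class {u} {v} (inj₂ vu) = cls v u vu

  colourOf : ∀ {u v} → Oriented u v → Fin (k * n)
  colourOf o = combine (class o) (tail o)

  colourOf-flip : ∀ {u v} (o : Oriented u v) (o' : Oriented v u) → colourOf o ≡ colourOf o'
  colourOf-flip (inj₁ uv) (inj₁ vu) = ⊥-elim (Arc-asym uv vu)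
  colourOf-flip {u} {v} (inj₁ uv) (inj₂ uv') = cong (λ d → combine (cls u v d) u) (Arc-irrelevant uv uv')
  colourOf-flip {u} {v} (inj₂ vu) (inj₁ vu') = cong (λ d → combine (cls v u d) v) (Arc-irrelevant vu vu')
  colourOf-flip (inj₂ vu) (inj₂ uv) = ⊥-elim (Arc-asym uv vu)

  colouring : Colouring G (k * n)
  colouring = record
    { col     = λ u v e → colourOf (orient e)
    ; col-sym = λ u v e e' → colourOf-flip (orient e) (orient e')
    }

  InClique : Fin k → Fin n → Fin n → Set
  InClique i x y = x ≡ y ⊎ Σ[ xy ∈ Arc x y ] cls x y xy ≡ i

  InClique-near : ∀ {i x y z} → InClique i x y → InClique i x z → Near {G = G} y z
  InClique-near (inj₁ refl) (inj₁ refl)     = inj₁ refl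
  InClique-near (inj₁ refl) (inj₂ (xz , _)) = inj₂ (arc-edge D _ _ xz)
  InClique-near (inj₂ (xy , _)) (inj₁ refl) = inj₂ (edge-sym {G = G} (arc-edge D _ _ xy))
  InClique-near {y = y} {z} (inj₂ (xy , cy)) (inj₂ (xz , cz)) with y ≟ z
  ... | yes y≡z = inj₁ y≡z
  ... | no  y≢z = inj₂ (clique _ y z xy xz (trans cy (sym cz)) y≢z)

  ends-InClique : ∀ {u v} (o : Oriented u v) → InClique (class o) (tail o) u × InClique (class o) (tail o) v
  ends-InClique (inj₁ uv) = inj₁ refl , inj₂ (uv , refl)
  ends-InClique (inj₂ vu) = inj₂ (vu , refl) , inj₁ refl

  sameColour-near : ∀ {u a b d} (o : Oriented u a) (o' : Oriented b d) →
    colourOf o ≡ colourOf o' → Near {G = G} u d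
  sameColour-near o o' same with combine-injective _ _ _ _ same
  ... | class≡ , tail≡ =
    InClique-near (proj₁ (ends-InClique o))
                  (subst₂ (λ i x → InClique i x _) (sym class≡) (sym tail≡) (proj₂ (ends-InClique o')))

  colourClassesSpanCliques : ColourClassesSpanCliques colouring
  colourClassesSpanCliques e f = sameColour-near (orient e) (orient f)

kPerfectlyOrientable⇒vsrc≤kn : ∀ {n k} {G : Graph n} → KPerfectlyOrientable k G → HasVSRC G (k * n)
kPerfectlyOrientable⇒vsrc≤kn (D , cls , clique) =
  colouring , cliqueColouring⇒veryStrong colourClassesSpanCliques
  where open KPerfectColouring D cls clique

corollary3 : ∀ {n} (G : Graph n) (k : ℕ) → KPerfectlyOrientable k G →
    ∀ (s t : ℕ) → IsSrc G s → IsVsrc G t → (s ≤ t) × (t ≤ k * n)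
corollary3 G k kpo s t isSrc (vsrcColouring , minimal) =
  src≤vsrc isSrc vsrcColouring , minimal _ (kPerfectlyOrientable⇒vsrc≤kn kpo)
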